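{- For all integers $k\ge 1$ and $j\ge 1$, $$S^{*}(k+2,j)=(j+1)\sum_{i=0}^{j-1}\frac{(-1)^{j-1-i}H_{i+1}^{(k)}}{(j-1-i)!\,(i+2)!}$$ and $$S^{*}(k+2,j)=(j+1)\sum_{i=0}^{j-1}\frac{(-1)^{j-1-i}}{(j-1-i)!}\left(\frac{H_{i+2}^{(k)}}{(i+2)!}-\frac{1}{(i+2)!\,(i+2)^k}\right).$$
   Context: For integers $k\ge 2$ and $j\ge 1$, $S^{*}(k,j)=\frac{1}{j!}\sum_{m=1}^{j}\binom{j}{m}\frac{(-1)^{j-m}}{m^{k-2}}$. For real $r$ and integer $n\ge0$, $H_n^{(r)}=\sum_{i=1}^{n} i^{ -r}$. -}

module Defs where

open import Data.Nat as ℕ using (ℕ; zero; suc)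
open import Data.Nat.Combinatorics using (_C_)
open import Data.Nat using (_!)
open import Data.Integer using (+_)
open import Data.Rational using (ℚ; _/_; _+_; _*_; _-_; -_; 0ℚ; 1ℚ)

-- reciprocal of a natural number as a rational; only ever applied to
-- positive arguments below (inv 0 = 0 is an unused junk value)
inv : ℕ → ℚ
inv zero = 0ℚ
inv (suc n) = + 1 / suc n

ℕtoℚ : ℕ → ℚ
ℕtoℚ n = + n / 1

sgn : ℕ → ℚ
sgn zero = 1ℚ
sgn (suc n) = - sgn n

-- Σ_{i=a}^{b} f i  (empty if b < a); written  sumFromTo a b f
-- implemented as Σ_{t=0}^{len-1} f (a + t)
sumLen : ℕ → (ℕ → ℚ) → ℚ
sumLen zero f = 0ℚ
sumLen (suc n) f = sumLen n f + f n

sumFromTo : ℕ → ℕ → (ℕ → ℚ) → ℚ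
sumFromTo a b f = sumLen (suc b ℕ.∸ a) (λ t → f (a ℕ.+ t))

H : ℕ → ℕ → ℚ
H n r = sumFromTo 1 n (λ i → inv (i ℕ.^ r))

Sstar : ℕ → ℕ → ℚ
Sstar k j = inv (j !) * sumFromTo 1 j
  (λ m → ℕtoℚ (j C m) * sgn (j ℕ.∸ m) * inv (m ℕ.^ (k ℕ.∸ 2)))

-- Put a_t = 1/(t+1)^k, so that H_{i+1}^{(k)} = Σ_{t≤i} a_t and S*(k+2, j) = (1/j!) Σ_{t<j} C(j,t+1) (-1)^{j-1-t} a_t.
-- Exchanging the order of summation turns the right-hand side of the first formula into
-- Σ_t a_t (j+1) Σ_{i=t}^{j-1} w_i with w_i = (-1)^{j-1-i} / ((j-1-i)! (i+2)!), and by downward induction on t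
-- these tail sums are (-1)^{j-1-t} / ((t+1)! (j-1-t)!) = C(j,t+1) (-1)^{j-1-t} / j!, the coefficient of a_t on the left.
-- Nothing is used about a, so the identity holds for every sequence in place of (1/(t+1)^k).
-- The second formula differs from the first only by H_{i+2}^{(k)} = H_{i+1}^{(k)} + 1/(i+2)^k.

module Submission where

import Data.Integer as ℤ
import Data.Integer.Properties as ℤ
open import Data.Nat as ℕ using (ℕ; zero; suc; NonZero; _!; _^_; _≥_; _∸_; _≤_; _<_; s≤s; z≤n)
import Data.Nat.Properties as ℕ
open import Data.Nat.Combinatorics using (_C_; nCk≡n!/k![n-k]!; k![n∸k]!∣n!)
open import Data.Nat.Coprimality using (1-coprimeTo) renaming (sym to coprime-sym)
open import Data.Nat.DivMod using (m/n*n≡m)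
open import Data.Product using (_×_; _,_)
open import Data.Rational using (ℚ; mkℚ; toℚᵘ; _+_; _*_; _-_; -_; 0ℚ; 1ℚ)
open import Data.Rational.Properties
import Data.Rational.Unnormalised as ℚᵘ
import Data.Rational.Unnormalised.Properties as ℚᵘ
open import Level using (0ℓ)
open import Relation.Binary.PropositionalEquality
open import Relation.Nullary.Decidable using (dec⇒maybe)
open import Tactic.RingSolver using (solve-∀)
open import Tactic.RingSolver.Core.AlmostCommutativeRing
  using (AlmostCommutativeRing; fromCommutativeRing)

open import Defs

ℚ-ring : AlmostCommutativeRing 0ℓ 0ℓ
ℚ-ring = fromCommutativeRing +-*-commutativeRing (λ x → dec⇒maybe (0ℚ ≟ x))

ℕtoℚ≡mkℚ : ∀ n → ℕtoℚ n ≡ mkℚ (ℤ.+ n) 0 (coprime-sym (1-coprimeTo n))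
ℕtoℚ≡mkℚ n = normalize-coprime (coprime-sym (1-coprimeTo n))

inv≡mkℚ : ∀ n → inv (suc n) ≡ mkℚ (ℤ.+ 1) n (1-coprimeTo (suc n))
inv≡mkℚ n = normalize-coprime (1-coprimeTo (suc n))

toℚᵘ-ℕtoℚ : ∀ n → toℚᵘ (ℕtoℚ n) ≡ ℚᵘ.mkℚᵘ (ℤ.+ n) 0
toℚᵘ-ℕtoℚ n = cong toℚᵘ (ℕtoℚ≡mkℚ n)

ℕtoℚ-+ : ∀ m n → ℕtoℚ (m ℕ.+ n) ≡ ℕtoℚ m + ℕtoℚ n
ℕtoℚ-+ m n = toℚᵘ-injective (begin
  toℚᵘ (ℕtoℚ (m ℕ.+ n))                 ≡⟨ toℚᵘ-ℕtoℚ (m ℕ.+ n) ⟩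
  ℚᵘ.mkℚᵘ (ℤ.+ (m ℕ.+ n)) 0               ≈⟨ ℚᵘ.*≡* (cong (ℤ._* ℤ.+ 1) pos-+′) ⟩
  ℚᵘ.mkℚᵘ (ℤ.+ m) 0 ℚᵘ.+ ℚᵘ.mkℚᵘ (ℤ.+ n) 0  ≡⟨ sym (cong₂ ℚᵘ._+_ (toℚᵘ-ℕtoℚ m) (toℚᵘ-ℕtoℚ n)) ⟩
  toℚᵘ (ℕtoℚ m) ℚᵘ.+ toℚᵘ (ℕtoℚ n)      ≈⟨ ℚᵘ.≃-sym (toℚᵘ-homo-+ (ℕtoℚ m) (ℕtoℚ n)) ⟩
  toℚᵘ (ℕtoℚ m + ℕtoℚ n)                ∎)
  where
  open ℚᵘ.≃-Reasoning
  pos-+′ : ℤ.+ (m ℕ.+ n) ≡ ℤ.+ m ℤ.* ℤ.+ 1 ℤ.+ ℤ.+ n ℤ.* ℤ.+ 1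
  pos-+′ = trans (ℤ.pos-+ m n) (sym (cong₂ ℤ._+_ (ℤ.*-identityʳ (ℤ.+ m)) (ℤ.*-identityʳ (ℤ.+ n))))

ℕtoℚ-* : ∀ m n → ℕtoℚ (m ℕ.* n) ≡ ℕtoℚ m * ℕtoℚ n
ℕtoℚ-* m n = toℚᵘ-injective (begin
  toℚᵘ (ℕtoℚ (m ℕ.* n))                 ≡⟨ toℚᵘ-ℕtoℚ (m ℕ.* n) ⟩
  ℚᵘ.mkℚᵘ (ℤ.+ (m ℕ.* n)) 0               ≈⟨ ℚᵘ.*≡* (cong (ℤ._* ℤ.+ 1) (ℤ.pos-* m n)) ⟩
  ℚᵘ.mkℚᵘ (ℤ.+ m) 0 ℚᵘ.* ℚᵘ.mkℚᵘ (ℤ.+ n) 0  ≡⟨ sym (cong₂ ℚᵘ._*_ (toℚᵘ-ℕtoℚ m) (toℚᵘ-ℕtoℚ n)) ⟩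
  toℚᵘ (ℕtoℚ m) ℚᵘ.* toℚᵘ (ℕtoℚ n)      ≈⟨ ℚᵘ.≃-sym (toℚᵘ-homo-* (ℕtoℚ m) (ℕtoℚ n)) ⟩
  toℚᵘ (ℕtoℚ m * ℕtoℚ n)                ∎)
  where open ℚᵘ.≃-Reasoning

open ≡-Reasoning

-- 1/ (mkℚ (ℤ.+ suc n) 0 _) computes to mkℚ (ℤ.+ 1) n _.
ℕtoℚ*inv≡1 : ∀ n .{{_ : NonZero n}} → ℕtoℚ n * inv n ≡ 1ℚ
ℕtoℚ*inv≡1 (suc n) = trans (cong₂ _*_ (ℕtoℚ≡mkℚ (suc n)) (inv≡mkℚ n))
  (*-inverseʳ (mkℚ (ℤ.+ suc n) 0 (coprime-sym (1-coprimeTo (suc n)))))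

inv-unique : ∀ m .{{_ : NonZero m}} {x} → ℕtoℚ m * x ≡ 1ℚ → inv m ≡ x
inv-unique m {x} mx≡1 = begin
  inv m                  ≡⟨ sym (*-identityʳ (inv m)) ⟩
  inv m * 1ℚ             ≡⟨ cong (inv m *_) (sym mx≡1) ⟩
  inv m * (ℕtoℚ m * x)   ≡⟨ sym (*-assoc (inv m) (ℕtoℚ m) x) ⟩
  (inv m * ℕtoℚ m) * x   ≡⟨ cong (_* x) (trans (*-comm (inv m) (ℕtoℚ m)) (ℕtoℚ*inv≡1 m)) ⟩
  1ℚ * x                 ≡⟨ *-identityˡ x ⟩
  x                      ∎

inv-* : ∀ m n .{{_ : NonZero m}} .{{_ : NonZero n}} → inv (m ℕ.* n) ≡ inv m * inv n
inv-* m n = inv-unique (m ℕ.* n) {{ℕ.m*n≢0 m n}} (begin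
  ℕtoℚ (m ℕ.* n) * (inv m * inv n)         ≡⟨ cong (_* (inv m * inv n)) (ℕtoℚ-* m n) ⟩
  (ℕtoℚ m * ℕtoℚ n) * (inv m * inv n)      ≡⟨ interchange (ℕtoℚ m) (ℕtoℚ n) (inv m) (inv n) ⟩
  (ℕtoℚ m * inv m) * (ℕtoℚ n * inv n)      ≡⟨ cong₂ _*_ (ℕtoℚ*inv≡1 m) (ℕtoℚ*inv≡1 n) ⟩
  1ℚ * 1ℚ                                  ≡⟨ *-identityˡ 1ℚ ⟩
  1ℚ                                       ∎)
  where
  interchange : ∀ a b c d → (a * b) * (c * d) ≡ (a * c) * (b * d)
  interchange = solve-∀ ℚ-ring

inv[n!]≡[1+n]*inv[[1+n]!] : ∀ n → inv (n !) ≡ ℕtoℚ (suc n) * inv (suc n !)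
inv[n!]≡[1+n]*inv[[1+n]!] n = sym (begin
  ℕtoℚ (suc n) * inv (suc n ℕ.* n !)             ≡⟨ cong (ℕtoℚ (suc n) *_) (inv-* (suc n) (n !) {{_}} {{n ℕ.!≢0}}) ⟩
  ℕtoℚ (suc n) * (inv (suc n) * inv (n !))       ≡⟨ sym (*-assoc (ℕtoℚ (suc n)) (inv (suc n)) (inv (n !))) ⟩
  (ℕtoℚ (suc n) * inv (suc n)) * inv (n !)       ≡⟨ cong (_* inv (n !)) (ℕtoℚ*inv≡1 (suc n)) ⟩
  1ℚ * inv (n !)                                 ≡⟨ *-identityˡ (inv (n !)) ⟩
  inv (n !)                                      ∎)

nCk*[k!*[n∸k]!]≡n! : ∀ {n k} → k ≤ n → (n C k) ℕ.* (k ! ℕ.* (n ∸ k) !) ≡ n !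
nCk*[k!*[n∸k]!]≡n! {n} {k} k≤n =
  trans (cong (ℕ._* (k ! ℕ.* (n ∸ k) !)) (nCk≡n!/k![n-k]! k≤n))
        (m/n*n≡m {{k ℕ.!* (n ∸ k) !≢0}} (k![n∸k]!∣n! k≤n))

inv[n!]*nCk≡inv[k!]*inv[[n∸k]!] : ∀ {n k} → k ≤ n →
  inv (n !) * ℕtoℚ (n C k) ≡ inv (k !) * inv ((n ∸ k) !)
inv[n!]*nCk≡inv[k!]*inv[[n∸k]!] {n} {k} k≤n = begin
  inv (n !) * ℕtoℚ (n C k)          ≡⟨ sym (inv-unique D {{k ℕ.!* (n ∸ k) !≢0}} D*[inv[n!]*nCk]≡1) ⟩
  inv D                             ≡⟨ inv-* (k !) ((n ∸ k) !) {{k ℕ.!≢0}} {{(n ∸ k) ℕ.!≢0}} ⟩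
  inv (k !) * inv ((n ∸ k) !)       ∎
  where
  D = k ! ℕ.* (n ∸ k) !
  regroup : ∀ d f c → d * (f * c) ≡ (c * d) * f
  regroup = solve-∀ ℚ-ring
  D*[inv[n!]*nCk]≡1 : ℕtoℚ D * (inv (n !) * ℕtoℚ (n C k)) ≡ 1ℚ
  D*[inv[n!]*nCk]≡1 = begin
    ℕtoℚ D * (inv (n !) * ℕtoℚ (n C k))   ≡⟨ regroup (ℕtoℚ D) (inv (n !)) (ℕtoℚ (n C k)) ⟩
    (ℕtoℚ (n C k) * ℕtoℚ D) * inv (n !)   ≡⟨ cong (_* inv (n !)) (sym (ℕtoℚ-* (n C k) D)) ⟩
    ℕtoℚ ((n C k) ℕ.* D) * inv (n !)      ≡⟨ cong (λ m → ℕtoℚ m * inv (n !)) (nCk*[k!*[n∸k]!]≡n! k≤n) ⟩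
    ℕtoℚ (n !) * inv (n !)                ≡⟨ ℕtoℚ*inv≡1 (n !) {{n ℕ.!≢0}} ⟩
    1ℚ                                    ∎

sumLen-cong : ∀ n {f g : ℕ → ℚ} → (∀ t → t < n → f t ≡ g t) → sumLen n f ≡ sumLen n g
sumLen-cong zero    f≗g = refl
sumLen-cong (suc n) f≗g =
  cong₂ _+_ (sumLen-cong n (λ t t<n → f≗g t (ℕ.m<n⇒m<1+n t<n))) (f≗g n (ℕ.n<1+n n))

sumLen-distrib-+ : ∀ n (f g : ℕ → ℚ) → sumLen n (λ t → f t + g t) ≡ sumLen n f + sumLen n g
sumLen-distrib-+ zero    f g = refl
sumLen-distrib-+ (suc n) f g =
  trans (cong (_+ (f n + g n)) (sumLen-distrib-+ n f g))
        (interchange (sumLen n f) (sumLen n g) (f n) (g n))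
  where
  interchange : ∀ a b c d → (a + b) + (c + d) ≡ (a + c) + (b + d)
  interchange = solve-∀ ℚ-ring

*-distribˡ-sumLen : ∀ n x (f : ℕ → ℚ) → x * sumLen n f ≡ sumLen n (λ t → x * f t)
*-distribˡ-sumLen zero    x f = *-zeroʳ x
*-distribˡ-sumLen (suc n) x f =
  trans (*-distribˡ-+ x (sumLen n f) (f n)) (cong (_+ x * f n) (*-distribˡ-sumLen n x f))

*-distribʳ-sumLen : ∀ n x (f : ℕ → ℚ) → sumLen n f * x ≡ sumLen n (λ t → f t * x)
*-distribʳ-sumLen zero    x f = *-zeroˡ x
*-distribʳ-sumLen (suc n) x f =
  trans (*-distribʳ-+ x (sumLen n f) (f n)) (cong (_+ f n * x) (*-distribʳ-sumLen n x f))

sumLen-head : ∀ n (f : ℕ → ℚ) → sumLen (suc n) f ≡ f 0 + sumLen n (λ t → f (suc t))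
sumLen-head zero    f = trans (+-identityˡ (f 0)) (sym (+-identityʳ (f 0)))
sumLen-head (suc n) f =
  trans (cong (_+ f (suc n)) (sumLen-head n f)) (+-assoc (f 0) (sumLen n (λ t → f (suc t))) (f (suc n)))

tailSum : (ℕ → ℚ) → ℕ → ℕ → ℚ
tailSum c N t = sumLen (N ∸ t) (λ u → c (t ℕ.+ u))

tailSum-suc : ∀ c {N t} → t ≤ N → tailSum c (suc N) t ≡ tailSum c N t + c N
tailSum-suc c {N} {t} t≤N =
  trans (cong (λ l → sumLen l (λ u → c (t ℕ.+ u))) (ℕ.+-∸-assoc 1 t≤N))
        (cong (tailSum c N t +_) (cong c (ℕ.m+[n∸m]≡n t≤N)))

tailSum-last : ∀ c N → tailSum c (suc N) N ≡ c N
tailSum-last c N = begin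
  sumLen (suc N ∸ N) (λ u → c (N ℕ.+ u))   ≡⟨ cong (λ l → sumLen l (λ u → c (N ℕ.+ u))) (ℕ.m+n∸n≡m 1 N) ⟩
  0ℚ + c (N ℕ.+ 0)                         ≡⟨ +-identityˡ (c (N ℕ.+ 0)) ⟩
  c (N ℕ.+ 0)                              ≡⟨ cong c (ℕ.+-identityʳ N) ⟩
  c N                                      ∎

sumLen-prefixSum-swap : ∀ N (c a : ℕ → ℚ) →
  sumLen N (λ i → c i * sumLen (suc i) a) ≡ sumLen N (λ t → a t * tailSum c N t)
sumLen-prefixSum-swap zero    c a = refl
sumLen-prefixSum-swap (suc N) c a = begin
  sumLen N (λ i → c i * sumLen (suc i) a) + c N * (P + a N)
    ≡⟨ cong (_+ c N * (P + a N)) (sumLen-prefixSum-swap N c a) ⟩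
  R + c N * (P + a N)
    ≡⟨ regroup R (c N) P (a N) ⟩
  (R + P * c N) + a N * c N
    ≡⟨ cong₂ _+_ (sym extend) (cong (a N *_) (sym (tailSum-last c N))) ⟩
  sumLen N (λ t → a t * tailSum c (suc N) t) + a N * tailSum c (suc N) N
    ∎
  where
  P = sumLen N a
  R = sumLen N (λ t → a t * tailSum c N t)
  regroup : ∀ r x p y → r + x * (p + y) ≡ (r + p * x) + y * x
  regroup = solve-∀ ℚ-ring
  extend : sumLen N (λ t → a t * tailSum c (suc N) t) ≡ R + P * c N
  extend = begin
    sumLen N (λ t → a t * tailSum c (suc N) t)
      ≡⟨ sumLen-cong N (λ t t<N → trans (cong (a t *_) (tailSum-suc c (ℕ.<⇒≤ t<N)))
                                         (*-distribˡ-+ (a t) (tailSum c N t) (c N))) ⟩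
    sumLen N (λ t → a t * tailSum c N t + a t * c N)
      ≡⟨ sumLen-distrib-+ N (λ t → a t * tailSum c N t) (λ t → a t * c N) ⟩
    R + sumLen N (λ t → a t * c N)
      ≡⟨ cong (R +_) (sym (*-distribʳ-sumLen N (c N) a)) ⟩
    R + P * c N
      ∎

-- w_i above, for j = n + 1
weight : ℕ → ℕ → ℚ
weight n i = sgn (n ∸ i) * inv ((n ∸ i) !) * inv ((i ℕ.+ 2) !)

-- the closed form of (n+2) Σ_{i=t}^{n} weight n i, for d = n - t
tailWeight : ℕ → ℕ → ℚ
tailWeight t d = sgn d * inv (suc t !) * inv (d !)

weight-offset : ∀ t d → weight (t ℕ.+ d) t ≡ sgn d * inv (d !) * inv (suc (suc t) !)
weight-offset t d =
  cong₂ (λ e m → sgn e * inv (e !) * inv (m !)) (ℕ.m+n∸m≡n t d) (ℕ.+-comm t 2)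

tailWeight-zero : ∀ t → tailWeight t 0 ≡ ℕtoℚ (suc (suc t)) * weight (t ℕ.+ 0) t
tailWeight-zero t = sym (begin
  ℕtoℚ (suc (suc t)) * weight (t ℕ.+ 0) t            ≡⟨ cong (ℕtoℚ (suc (suc t)) *_) (weight-offset t 0) ⟩
  ℕtoℚ (suc (suc t)) * (1ℚ * inv (suc (suc t) !))    ≡⟨ cong (ℕtoℚ (suc (suc t)) *_) (*-identityˡ _) ⟩
  ℕtoℚ (suc (suc t)) * inv (suc (suc t) !)           ≡⟨ sym (inv[n!]≡[1+n]*inv[[1+n]!] (suc t)) ⟩
  inv (suc t !)                                      ≡⟨ sym (trans (*-identityʳ _) (*-identityˡ _)) ⟩
  1ℚ * inv (suc t !) * 1ℚ                            ∎)

tailWeight-suc : ∀ t d →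
  tailWeight t (suc d) ≡ ℕtoℚ (suc (suc t) ℕ.+ suc d) * weight (t ℕ.+ suc d) t + tailWeight (suc t) d
tailWeight-suc t d = begin
  - s * inv (suc t !) * inv (suc d !)
    ≡⟨ cong (λ x → - s * x * b) (inv[n!]≡[1+n]*inv[[1+n]!] (suc t)) ⟩
  - s * (T * a) * b
    ≡⟨ identity T D s a b ⟩
  (T + D) * (- s * b * a) + s * a * (D * b)
    ≡⟨ cong₂ _+_ (sym (cong₂ _*_ (ℕtoℚ-+ (suc (suc t)) (suc d)) (weight-offset t (suc d))))
                 (cong (s * a *_) (sym (inv[n!]≡[1+n]*inv[[1+n]!] d))) ⟩
  ℕtoℚ (suc (suc t) ℕ.+ suc d) * weight (t ℕ.+ suc d) t + s * a * inv (d !)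
    ∎
  where
  s = sgn d
  a = inv (suc (suc t) !)
  b = inv (suc d !)
  T = ℕtoℚ (suc (suc t))
  D = ℕtoℚ (suc d)
  identity : ∀ T D s a b → - s * (T * a) * b ≡ (T + D) * (- s * b * a) + s * a * (D * b)
  identity = solve-∀ ℚ-ring

sumLen-weight≡tailWeight : ∀ {n} t d → t ℕ.+ d ≡ n →
  ℕtoℚ (suc (suc n)) * sumLen (suc d) (λ u → weight n (t ℕ.+ u)) ≡ tailWeight t d
sumLen-weight≡tailWeight t zero refl = begin
  ℕtoℚ (suc (suc (t ℕ.+ 0))) * (0ℚ + weight (t ℕ.+ 0) (t ℕ.+ 0))
    ≡⟨ cong₂ _*_ (cong (λ m → ℕtoℚ (suc (suc m))) (ℕ.+-identityʳ t))
                 (trans (+-identityˡ _) (cong (weight (t ℕ.+ 0)) (ℕ.+-identityʳ t))) ⟩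
  ℕtoℚ (suc (suc t)) * weight (t ℕ.+ 0) t
    ≡⟨ sym (tailWeight-zero t) ⟩
  tailWeight t 0
    ∎
sumLen-weight≡tailWeight {n} t (suc d) refl = begin
  N * sumLen (suc (suc d)) (λ u → weight n (t ℕ.+ u))
    ≡⟨ cong (N *_) (sumLen-head (suc d) (λ u → weight n (t ℕ.+ u))) ⟩
  N * (weight n (t ℕ.+ 0) + sumLen (suc d) (λ u → weight n (t ℕ.+ suc u)))
    ≡⟨ *-distribˡ-+ N _ _ ⟩
  N * weight n (t ℕ.+ 0) + N * sumLen (suc d) (λ u → weight n (t ℕ.+ suc u))
    ≡⟨ cong₂ (λ i s → N * weight n i + N * s) (ℕ.+-identityʳ t)
             (sumLen-cong (suc d) (λ u _ → cong (weight n) (ℕ.+-suc t u))) ⟩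
  N * weight n t + N * sumLen (suc d) (λ u → weight n (suc t ℕ.+ u))
    ≡⟨ cong (N * weight n t +_) (sumLen-weight≡tailWeight (suc t) d (sym (ℕ.+-suc t d))) ⟩
  N * weight n t + tailWeight (suc t) d
    ≡⟨ sym (tailWeight-suc t d) ⟩
  tailWeight t (suc d)
    ∎
  where N = ℕtoℚ (suc (suc n))

binomialSum≡tailWeightSum : ∀ n (a : ℕ → ℚ) →
  inv (suc n !) * sumLen (suc n) (λ t → ℕtoℚ (suc n C suc t) * sgn (n ∸ t) * a t)
    ≡ sumLen (suc n) (λ t → a t * tailWeight t (n ∸ t))
binomialSum≡tailWeightSum n a =
  trans (*-distribˡ-sumLen (suc n) (inv (suc n !)) _) (sumLen-cong (suc n) coefficient)
  where
  regroup : ∀ f c s x → f * (c * s * x) ≡ x * (s * (f * c))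
  regroup = solve-∀ ℚ-ring
  coefficient : ∀ t → t < suc n →
    inv (suc n !) * (ℕtoℚ (suc n C suc t) * sgn (n ∸ t) * a t) ≡ a t * tailWeight t (n ∸ t)
  coefficient t t<1+n = begin
    inv (suc n !) * (ℕtoℚ (suc n C suc t) * sgn (n ∸ t) * a t)
      ≡⟨ regroup (inv (suc n !)) (ℕtoℚ (suc n C suc t)) (sgn (n ∸ t)) (a t) ⟩
    a t * (sgn (n ∸ t) * (inv (suc n !) * ℕtoℚ (suc n C suc t)))
      ≡⟨ cong (λ x → a t * (sgn (n ∸ t) * x)) (inv[n!]*nCk≡inv[k!]*inv[[n∸k]!] t<1+n) ⟩
    a t * (sgn (n ∸ t) * (inv (suc t !) * inv ((n ∸ t) !)))
      ≡⟨ cong (a t *_) (sym (*-assoc (sgn (n ∸ t)) _ _)) ⟩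
    a t * tailWeight t (n ∸ t)
      ∎

weightedPrefixSum≡tailWeightSum : ∀ n (a : ℕ → ℚ) →
  ℕtoℚ (suc (suc n)) * sumLen (suc n) (λ i → weight n i * sumLen (suc i) a)
    ≡ sumLen (suc n) (λ t → a t * tailWeight t (n ∸ t))
weightedPrefixSum≡tailWeightSum n a = begin
  N * sumLen (suc n) (λ i → weight n i * sumLen (suc i) a)
    ≡⟨ cong (N *_) (sumLen-prefixSum-swap (suc n) (weight n) a) ⟩
  N * sumLen (suc n) (λ t → a t * tailSum (weight n) (suc n) t)
    ≡⟨ *-distribˡ-sumLen (suc n) N _ ⟩
  sumLen (suc n) (λ t → N * (a t * tailSum (weight n) (suc n) t))
    ≡⟨ sumLen-cong (suc n) coefficient ⟩
  sumLen (suc n) (λ t → a t * tailWeight t (n ∸ t))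
    ∎
  where
  N = ℕtoℚ (suc (suc n))
  coefficient : ∀ t → t < suc n → N * (a t * tailSum (weight n) (suc n) t) ≡ a t * tailWeight t (n ∸ t)
  coefficient t (s≤s t≤n) = begin
    N * (a t * tailSum (weight n) (suc n) t)
      ≡⟨ x*[y*z]≡y*[x*z] N (a t) _ ⟩
    a t * (N * sumLen (suc n ∸ t) (λ u → weight n (t ℕ.+ u)))
      ≡⟨ cong (λ l → a t * (N * sumLen l (λ u → weight n (t ℕ.+ u)))) (ℕ.+-∸-assoc 1 t≤n) ⟩
    a t * (N * sumLen (suc (n ∸ t)) (λ u → weight n (t ℕ.+ u)))
      ≡⟨ cong (a t *_) (sumLen-weight≡tailWeight t (n ∸ t) (ℕ.m+[n∸m]≡n t≤n)) ⟩
    a t * tailWeight t (n ∸ t)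
      ∎
    where
    x*[y*z]≡y*[x*z] : ∀ x y z → x * (y * z) ≡ y * (x * z)
    x*[y*z]≡y*[x*z] = solve-∀ ℚ-ring

H-suc*inv!-correction : ∀ m k →
  H (suc m) k * inv (suc m !) - inv (suc m ! ℕ.* suc m ^ k) ≡ H m k * inv (suc m !)
H-suc*inv!-correction m k = begin
  (P + p) * g - inv (suc m ! ℕ.* suc m ^ k)
    ≡⟨ cong (λ x → (P + p) * g - x) (inv-* (suc m !) (suc m ^ k) {{suc m ℕ.!≢0}} {{ℕ.m^n≢0 (suc m) k}}) ⟩
  (P + p) * g - g * p
    ≡⟨ cancel P p g ⟩
  P * g
    ∎
  where
  P = H m k
  p = inv (suc m ^ k)
  g = inv (suc m !)
  cancel : ∀ P p g → (P + p) * g - g * p ≡ P * g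
  cancel = solve-∀ ℚ-ring

weight*H≡firstSummand : ∀ n k i →
  weight n i * H (suc i) k ≡ sgn (n ∸ i) * H (i ℕ.+ 1) k * inv ((n ∸ i) !) * inv ((i ℕ.+ 2) !)
weight*H≡firstSummand n k i = begin
  sgn (n ∸ i) * inv ((n ∸ i) !) * inv ((i ℕ.+ 2) !) * H (suc i) k
    ≡⟨ regroup (sgn (n ∸ i)) (inv ((n ∸ i) !)) (inv ((i ℕ.+ 2) !)) (H (suc i) k) ⟩
  sgn (n ∸ i) * H (suc i) k * inv ((n ∸ i) !) * inv ((i ℕ.+ 2) !)
    ≡⟨ cong (λ m → sgn (n ∸ i) * H m k * inv ((n ∸ i) !) * inv ((i ℕ.+ 2) !)) (ℕ.+-comm 1 i) ⟩
  sgn (n ∸ i) * H (i ℕ.+ 1) k * inv ((n ∸ i) !) * inv ((i ℕ.+ 2) !)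
    ∎
  where
  regroup : ∀ s f g P → s * f * g * P ≡ s * P * f * g
  regroup = solve-∀ ℚ-ring

secondSummand≡firstSummand : ∀ n k i →
  sgn (n ∸ i) * inv ((n ∸ i) !) * (H (i ℕ.+ 2) k * inv ((i ℕ.+ 2) !) - inv ((i ℕ.+ 2) ! ℕ.* (i ℕ.+ 2) ^ k))
    ≡ sgn (n ∸ i) * H (i ℕ.+ 1) k * inv ((n ∸ i) !) * inv ((i ℕ.+ 2) !)
secondSummand≡firstSummand n k i = begin
  s * f * (H (i ℕ.+ 2) k * inv ((i ℕ.+ 2) !) - inv ((i ℕ.+ 2) ! ℕ.* (i ℕ.+ 2) ^ k))
    ≡⟨ cong (λ m → s * f * (H m k * inv (m !) - inv (m ! ℕ.* m ^ k))) (ℕ.+-suc i 1) ⟩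
  s * f * (H (suc (i ℕ.+ 1)) k * inv (suc (i ℕ.+ 1) !) - inv (suc (i ℕ.+ 1) ! ℕ.* suc (i ℕ.+ 1) ^ k))
    ≡⟨ cong (s * f *_) (H-suc*inv!-correction (i ℕ.+ 1) k) ⟩
  s * f * (H (i ℕ.+ 1) k * inv (suc (i ℕ.+ 1) !))
    ≡⟨ cong (λ m → s * f * (H (i ℕ.+ 1) k * inv (m !))) (sym (ℕ.+-suc i 1)) ⟩
  s * f * (H (i ℕ.+ 1) k * inv ((i ℕ.+ 2) !))
    ≡⟨ regroup s f (H (i ℕ.+ 1) k) (inv ((i ℕ.+ 2) !)) ⟩
  s * H (i ℕ.+ 1) k * f * inv ((i ℕ.+ 2) !)
    ∎
  where
  s = sgn (n ∸ i)
  f = inv ((n ∸ i) !)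
  regroup : ∀ s f P g → s * f * (P * g) ≡ s * P * f * g
  regroup = solve-∀ ℚ-ring

proposition3p1 : ∀ (k j : ℕ) → k ≥ 1 → j ≥ 1 →
    (Sstar (k ℕ.+ 2) j ≡ ℕtoℚ (j ℕ.+ 1) * sumFromTo 0 (j ∸ 1) (λ i →
        sgn (j ∸ 1 ∸ i) * H (i ℕ.+ 1) k * inv ((j ∸ 1 ∸ i) !) * inv ((i ℕ.+ 2) !)))
    × (Sstar (k ℕ.+ 2) j ≡ ℕtoℚ (j ℕ.+ 1) * sumFromTo 0 (j ∸ 1) (λ i →
        sgn (j ∸ 1 ∸ i) * inv ((j ∸ 1 ∸ i) !) *
          (H (i ℕ.+ 2) k * inv ((i ℕ.+ 2) !) - inv (((i ℕ.+ 2) !) ℕ.* ((i ℕ.+ 2) ^ k)))))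
proposition3p1 k (suc n) _ (s≤s z≤n) = first , second
  where
  a : ℕ → ℚ
  a t = inv (suc t ^ k)
  first = begin
    Sstar (k ℕ.+ 2) (suc n)
      ≡⟨ cong (λ e → inv (suc n !) * sumLen (suc n) (λ t → ℕtoℚ (suc n C suc t) * sgn (n ∸ t) * inv (suc t ^ e)))
              (ℕ.m+n∸n≡m k 2) ⟩
    inv (suc n !) * sumLen (suc n) (λ t → ℕtoℚ (suc n C suc t) * sgn (n ∸ t) * a t)
      ≡⟨ binomialSum≡tailWeightSum n a ⟩
    sumLen (suc n) (λ t → a t * tailWeight t (n ∸ t))
      ≡⟨ sym (weightedPrefixSum≡tailWeightSum n a) ⟩
    ℕtoℚ (suc (suc n)) * sumLen (suc n) (λ i → weight n i * sumLen (suc i) a)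
      ≡⟨ cong₂ _*_ (cong ℕtoℚ (ℕ.+-comm 1 (suc n))) (sumLen-cong (suc n) (λ i _ → weight*H≡firstSummand n k i)) ⟩
    ℕtoℚ (suc n ℕ.+ 1) * sumLen (suc n) (λ i → sgn (n ∸ i) * H (i ℕ.+ 1) k * inv ((n ∸ i) !) * inv ((i ℕ.+ 2) !))
      ∎
  second = trans first (cong (ℕtoℚ (suc n ℕ.+ 1) *_)
    (sumLen-cong (suc n) (λ i _ → sym (secondSummand≡firstSummand n k i))))
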